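{- For every finite set $\Gamma$ of (ground) messages and message $M$, the judgment $\Gamma\vdash M$ is derivable in the natural deduction system $\mathcal N$ if and only if $\downarrow\Gamma\vdash\downarrow M$ is derivable in the sequent system $\mathcal S$.
   Context: Messages: built from names, constructors $\mathsf{pub}$ (unary), $\mathsf{sign}$, $\mathsf{blind}$, $\langle\cdot,\cdot\rangle$, $\{\cdot\}_\cdot$ (binary), and function symbols of a finite signature $\Sigma_E$ disjoint from the constructors; messages are ground. $E$: equational theory over $\Sigma_E$ with at most one AC symbol $\oplus$, presented by a rewrite system $R_E$ terminating and confluent modulo AC. $\equiv$: equality modulo AC; $\approx_E$: equality modulo $E$; $\downarrow M$: normal form of $M$ (modulo AC), extended to sets. $E$-alien term: headed by a symbol not in $\Sigma_E$. An $E$-alien subterm $A$ of $N$ is an $E$-factor of $N$ if it is an immediate subterm of a subterm of $N$ headed by a symbol of $\Sigma_E$ (of a set: of some member). $E$-context: term built from holes using only symbols of $\Sigma_E$. $\Gamma,M$ denotes $\Gamma\cup\{M\}$. System $\mathcal N$ (premises $\Rightarrow$ conclusion): (id) $\Gamma\vdash M$ if $M\in\Gamma$; ($e_E$) $\Gamma\vdash\{M\}_K$, $\Gamma\vdash K\Rightarrow\Gamma\vdash M$; ($e_I$) $\Gamma\vdash M,\Gamma\vdash K\Rightarrow\Gamma\vdash\{M\}_K$; ($p_E$) $\Gamma\vdash\langle M,N\rangle\Rightarrow\Gamma\vdash M$ and $\Gamma\vdash\langle M,N\rangle\Rightarrow\Gamma\vdash N$; ($p_I$) $\Gamma\vdash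 M,\Gamma\vdash N\Rightarrow\Gamma\vdash\langle M,N\rangle$; ($\mathsf{sign}_E$) $\Gamma\vdash\mathsf{sign}(M,K)$, $\Gamma\vdash\mathsf{pub}(K)\Rightarrow\Gamma\vdash M$; ($\mathsf{sign}_I$) $\Gamma\vdash M,\Gamma\vdash K\Rightarrow\Gamma\vdash\mathsf{sign}(M,K)$; ($\mathsf{blind}_{E1}$) $\Gamma\vdash\mathsf{blind}(M,K)$, $\Gamma\vdash K\Rightarrow\Gamma\vdash M$; ($\mathsf{blind}_I$) $\Gamma\vdash M,\Gamma\vdash K\Rightarrow\Gamma\vdash\mathsf{blind}(M,K)$; ($\mathsf{blind}_{E2}$) $\Gamma\vdash\mathsf{sign}(\mathsf{blind}(M,R),K)$, $\Gamma\vdash R\Rightarrow\Gamma\vdash\mathsf{sign}(M,K)$; ($f_I$) for $f\in\Sigma_E$: $\Gamma\vdash M_1,\ldots,\Gamma\vdash M_n\Rightarrow\Gamma\vdash f(M_1,\ldots,M_n)$; ($\approx$) $\Gamma\vdash N\Rightarrow\Gamma\vdash M$ if $M\approx_E N$. System $\mathcal S$ (on sequents whose terms are $E$-normal): (id) $\Gamma\vdash M$ if $M\approx_E C[M_1,\ldots,M_k]$ for an $E$-context $C$ and $M_i\in\Gamma$; (cut) $\Gamma\vdash M,\Gamma,M\vdash T\Rightarrow\Gamma\vdash T$; ($p_L$) $\Gamma,\langle M,N\rangle,M,N\vdash T\Rightarrow\Gamma,\langle M,N\rangle\vdash T$; ($p_R$) as $p_I$; ($e_L$) $\Gamma,\{M\}_K\vdash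 K$, $\Gamma,\{M\}_K,M,K\vdash N\Rightarrow\Gamma,\{M\}_K\vdash N$; ($e_R$) as $e_I$; ($\mathsf{sign}_L$) $\Gamma,\mathsf{sign}(M,K),\mathsf{pub}(L),M\vdash N\Rightarrow\Gamma,\mathsf{sign}(M,K),\mathsf{pub}(L)\vdash N$ if $K\equiv L$; ($\mathsf{sign}_R$) as $\mathsf{sign}_I$; ($\mathsf{blind}_{L1}$) $\Gamma,\mathsf{blind}(M,K)\vdash K$, $\Gamma,\mathsf{blind}(M,K),M,K\vdash N\Rightarrow\Gamma,\mathsf{blind}(M,K)\vdash N$; ($\mathsf{blind}_R$) as $\mathsf{blind}_I$; ($\mathsf{blind}_{L2}$) $\Gamma,\mathsf{sign}(\mathsf{blind}(M,R),K)\vdash R$, $\Gamma,\mathsf{sign}(\mathsf{blind}(M,R),K),\mathsf{sign}(M,K),R\vdash N\Rightarrow\Gamma,\mathsf{sign}(\mathsf{blind}(M,R),K)\vdash N$; (acut) $\Gamma\vdash A,\Gamma,A\vdash M\Rightarrow\Gamma\vdash M$ where $A$ is an $E$-factor of $\Gamma\cup\{M\}$. -}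

module Defs where

open import Data.Nat using (ℕ)
open import Data.Fin using (Fin)
open import Data.Vec using (Vec; []; _∷_; lookup; _[_]≔_)
open import Data.List using (List; _∷_)
open import Data.List.Membership.Propositional using (_∈_)
open import Data.Maybe using (Maybe; just)
open import Data.Product using (Σ; ∃; ∃₂; _×_; _,_)
open import Data.Sum using (_⊎_)
open import Data.Unit using (⊤)
open import Data.Empty using (⊥)
open import Function using (flip)
open import Relation.Nullary using (¬_)
open import Relation.Binary.PropositionalEquality using (_≡_)
open import Relation.Binary.Construct.Closure.ReflexiveTransitive using (Star)
open import Relation.Binary.Construct.Closure.Equivalence using (EqClosure)
open import Induction.WellFounded using (WellFounded)

-- Terms over Σ_E with variables (used for rewrite rules and E-contexts)

data ETerm (Sym : ℕ → Set) (X : Set) : Set where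
  var : X → ETerm Sym X
  app : ∀ {n} → Sym n → Vec (ETerm Sym X) n → ETerm Sym X

data Msg (Sym : ℕ → Set) : Set where
  name  : ℕ → Msg Sym
  pub   : Msg Sym → Msg Sym
  sign  : Msg Sym → Msg Sym → Msg Sym
  blind : Msg Sym → Msg Sym → Msg Sym
  ⟨_,_⟩ : Msg Sym → Msg Sym → Msg Sym
  enc   : Msg Sym → Msg Sym → Msg Sym   -- enc M K  is  {M}_K
  fun   : ∀ {n} → Sym n → Vec (Msg Sym) n → Msg Sym

-- A presentation of the equational theory E:
-- a finite signature Σ_E, at most one AC symbol ⊕ (of arity 2),
-- and a rewrite system R_E whose rules are pairs of Σ_E-terms with variables.

record Presentation : Set₁ where
  field
    Sym     : ℕ → Set
    symbols : List (Σ ℕ Sym)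
    finite  : ∀ {n} (f : Sym n) → (n , f) ∈ symbols
    acSym   : Maybe (Sym 2)
    rules   : List (ETerm Sym ℕ × ETerm Sym ℕ)

module Over (P : Presentation) where
  open Presentation P

  M : Set
  M = Msg Sym

  inst    : ∀ {X} → ETerm Sym X → (X → M) → M
  instVec : ∀ {X n} → Vec (ETerm Sym X) n → (X → M) → Vec M n
  inst (var x)    σ = σ x
  inst (app f ts) σ = fun f (instVec ts σ)
  instVec []       σ = []
  instVec (t ∷ ts) σ = inst t σ ∷ instVec ts σ

  data Ctx (R : M → M → Set) : M → M → Set where
    root   : ∀ {A B} → R A B → Ctx R A B
    pubC   : ∀ {A B} → Ctx R A B → Ctx R (pub A) (pub B)
    signˡ  : ∀ {A B K} → Ctx R A B → Ctx R (sign A K) (sign B K)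
    signʳ  : ∀ {A B K} → Ctx R A B → Ctx R (sign K A) (sign K B)
    blindˡ : ∀ {A B K} → Ctx R A B → Ctx R (blind A K) (blind B K)
    blindʳ : ∀ {A B K} → Ctx R A B → Ctx R (blind K A) (blind K B)
    pairˡ  : ∀ {A B K} → Ctx R A B → Ctx R ⟨ A , K ⟩ ⟨ B , K ⟩
    pairʳ  : ∀ {A B K} → Ctx R A B → Ctx R ⟨ K , A ⟩ ⟨ K , B ⟩
    encˡ   : ∀ {A B K} → Ctx R A B → Ctx R (enc A K) (enc B K)
    encʳ   : ∀ {A B K} → Ctx R A B → Ctx R (enc K A) (enc K B)
    funC   : ∀ {n} (f : Sym n) (xs : Vec M n) (i : Fin n) {B} →
             Ctx R (lookup xs i) B → Ctx R (fun f xs) (fun f (xs [ i ]≔ B))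

  data ACAxiom : M → M → Set where
    comm  : ∀ {f} → acSym ≡ just f → ∀ a b →
            ACAxiom (fun f (a ∷ b ∷ [])) (fun f (b ∷ a ∷ []))
    assoc : ∀ {f} → acSym ≡ just f → ∀ a b c →
            ACAxiom (fun f (fun f (a ∷ b ∷ []) ∷ c ∷ []))
                    (fun f (a ∷ fun f (b ∷ c ∷ []) ∷ []))

  _≡AC_ : M → M → Set
  _≡AC_ = EqClosure (Ctx ACAxiom)

  data RootStep : M → M → Set where
    rule : ∀ {l r} → (l , r) ∈ rules → (σ : ℕ → M) →
           RootStep (inst l σ) (inst r σ)

  _⟶_ : M → M → Set
  _⟶_ = Ctx RootStep

  _⟶ₐ_ : M → M → Set
  A ⟶ₐ B = ∃₂ λ A' B' → A ≡AC A' × A' ⟶ B' × B' ≡AC B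

  _⟶ₐ*_ : M → M → Set
  _⟶ₐ*_ = Star _⟶ₐ_

  _≈E_ : M → M → Set
  _≈E_ = EqClosure (λ A B → A ⟶ B ⊎ Ctx ACAxiom A B)

  Terminating : Set
  Terminating = WellFounded (flip _⟶ₐ_)

  ConfluentModAC : Set
  ConfluentModAC = ∀ {A B₁ B₂} → A ⟶ₐ* B₁ → A ⟶ₐ* B₂ →
    ∃₂ λ C₁ C₂ → B₁ ⟶ₐ* C₁ × B₂ ⟶ₐ* C₂ × C₁ ≡AC C₂

  Normal : M → Set
  Normal A = ∀ B → ¬ (A ⟶ₐ B)

  NormalFormOf : M → M → Set
  NormalFormOf N A = (∃ λ A' → A ⟶ₐ* A' × A' ≡AC N) × Normal N

  Alien : M → Set
  Alien (fun _ _) = ⊥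
  Alien _         = ⊤

  data _⊑_ (A : M) : M → Set where
    here   : A ⊑ A
    pubₛ   : ∀ {B} → A ⊑ B → A ⊑ pub B
    signˡ  : ∀ {B K} → A ⊑ B → A ⊑ sign B K
    signʳ  : ∀ {B K} → A ⊑ B → A ⊑ sign K B
    blindˡ : ∀ {B K} → A ⊑ B → A ⊑ blind B K
    blindʳ : ∀ {B K} → A ⊑ B → A ⊑ blind K B
    pairˡ  : ∀ {B K} → A ⊑ B → A ⊑ ⟨ B , K ⟩
    pairʳ  : ∀ {B K} → A ⊑ B → A ⊑ ⟨ K , B ⟩
    encˡ   : ∀ {B K} → A ⊑ B → A ⊑ enc B K
    encʳ   : ∀ {B K} → A ⊑ B → A ⊑ enc K B
    funₛ   : ∀ {n} {f : Sym n} {xs : Vec M n} (i : Fin n) →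
             A ⊑ lookup xs i → A ⊑ fun f xs

  EFactor : M → M → Set
  EFactor A N = Alien A × ∃ λ n → Σ (Sym n) λ f → Σ (Vec M n) λ xs →
    Σ (Fin n) λ i → lookup xs i ≡ A × fun f xs ⊑ N

  EFactorOf : M → List M → Set
  EFactorOf A Γ = ∃ λ N → N ∈ Γ × EFactor A N

  -- Γ , X  is written  X ∷ Γ ; finite sets are lists (membership-based rules)

  infix 4 _⊢N_ _⊢S_
  data _⊢N_ (Γ : List M) : M → Set where
    idN     : ∀ {A} → A ∈ Γ → Γ ⊢N A
    eE      : ∀ {A K} → Γ ⊢N enc A K → Γ ⊢N K → Γ ⊢N A
    eI      : ∀ {A K} → Γ ⊢N A → Γ ⊢N K → Γ ⊢N enc A K
    pE₁     : ∀ {A B} → Γ ⊢N ⟨ A , B ⟩ → Γ ⊢N A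
    pE₂     : ∀ {A B} → Γ ⊢N ⟨ A , B ⟩ → Γ ⊢N B
    pI      : ∀ {A B} → Γ ⊢N A → Γ ⊢N B → Γ ⊢N ⟨ A , B ⟩
    signE   : ∀ {A K} → Γ ⊢N sign A K → Γ ⊢N pub K → Γ ⊢N A
    signI   : ∀ {A K} → Γ ⊢N A → Γ ⊢N K → Γ ⊢N sign A K
    blindE₁ : ∀ {A K} → Γ ⊢N blind A K → Γ ⊢N K → Γ ⊢N A
    blindI  : ∀ {A K} → Γ ⊢N A → Γ ⊢N K → Γ ⊢N blind A K
    blindE₂ : ∀ {A R K} → Γ ⊢N sign (blind A R) K → Γ ⊢N R → Γ ⊢N sign A K
    fI      : ∀ {n} (f : Sym n) (xs : Vec M n) →
              (∀ i → Γ ⊢N lookup xs i) → Γ ⊢N fun f xs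
    eqE     : ∀ {A B} → Γ ⊢N B → A ≈E B → Γ ⊢N A

  data _⊢S_ : List M → M → Set where
    idS     : ∀ {Γ A} (k : ℕ) (C : ETerm Sym (Fin k)) (ms : Fin k → M) →
              (∀ i → ms i ∈ Γ) → A ≈E inst C ms → Γ ⊢S A
    cut     : ∀ {Γ A T} → Normal A → Γ ⊢S A → A ∷ Γ ⊢S T → Γ ⊢S T
    pL      : ∀ {Γ A B T} → ⟨ A , B ⟩ ∈ Γ → A ∷ B ∷ Γ ⊢S T → Γ ⊢S T
    pR      : ∀ {Γ A B} → Γ ⊢S A → Γ ⊢S B → Γ ⊢S ⟨ A , B ⟩
    eL      : ∀ {Γ A K T} → enc A K ∈ Γ → Γ ⊢S K → A ∷ K ∷ Γ ⊢S T → Γ ⊢S T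
    eR      : ∀ {Γ A K} → Γ ⊢S A → Γ ⊢S K → Γ ⊢S enc A K
    signL   : ∀ {Γ A K L T} → sign A K ∈ Γ → pub L ∈ Γ → K ≡AC L →
              A ∷ Γ ⊢S T → Γ ⊢S T
    signR   : ∀ {Γ A K} → Γ ⊢S A → Γ ⊢S K → Γ ⊢S sign A K
    blindL₁ : ∀ {Γ A K T} → blind A K ∈ Γ → Γ ⊢S K → A ∷ K ∷ Γ ⊢S T → Γ ⊢S T
    blindR  : ∀ {Γ A K} → Γ ⊢S A → Γ ⊢S K → Γ ⊢S blind A K
    blindL₂ : ∀ {Γ A R K T} → sign (blind A R) K ∈ Γ → Γ ⊢S R →
              sign A K ∷ R ∷ Γ ⊢S T → Γ ⊢S T
    acut    : ∀ {Γ A T} → EFactorOf A (T ∷ Γ) → Γ ⊢S A → A ∷ Γ ⊢S T → Γ ⊢S T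

module Submission where

-- Every rule of 𝒮 is admissible in 𝒩: right rules are
-- introductions, (id) is rebuilt by (f_I) and (≈), cuts and left rules are
-- substitutions of 𝒩-derivations for hypotheses; as ↓A ≈E A, a derivation
-- of ↓Γ ⊢ ↓M yields Γ ⊢ M.
--
-- The key fact is an
-- inversion property of reduction modulo AC (the relation Red below): a term
-- c(a,b) headed by a constructor c ∈ {pub, sign, blind, ⟨_,_⟩, {_}_} only
-- reduces below its head, since AC acts under Σ_E-symbols only and no rule of
-- R_E has a variable as left-hand side (that would contradict termination).
-- So ↓c(A,K) = c(X,Y) with A ⇝* X and K ⇝* Y, and every 𝒩 rule is simulated
-- by the matching right rule, or by a cut on a normal form followed by the
-- matching left rule; (f_I) cuts in the normal forms of the arguments and
-- closes with (id) on f(□,…,□).  Normal forms are given by nf.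

open import Defs
open import Data.Nat using (zero; suc)
open import Data.Fin using (Fin; zero; suc)
open import Data.Vec using (Vec; []; _∷_; lookup; _[_]≔_; tabulate)
open import Data.Vec.Properties using (lookup∘update; []≔-idempotent; []≔-lookup; lookup∘tabulate)
open import Data.List using (List; map; _∷_)
open import Data.List.Membership.Propositional using (_∈_)
open import Data.List.Membership.Propositional.Properties using (∈-map⁺; ∈-map⁻)
open import Data.List.Relation.Unary.Any using (here; there)
open import Data.List.Relation.Binary.Subset.Propositional using (_⊆_)
open import Data.List.Relation.Binary.Subset.Propositional.Properties using (∷⁺ʳ; xs⊆x∷xs)
open import Data.Product using (∃; ∃₂; _×_; _,_; proj₂)
open import Data.Sum using (_⊎_; inj₁; inj₂)
import Data.Sum as Sum
open import Data.Unit using (tt)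
open import Data.Empty using (⊥; ⊥-elim)
open import Function using (flip; _∘_)
open import Function.Bundles using (_⇔_; mk⇔)
open import Relation.Nullary using (¬_)
open import Relation.Binary.Core using (_⇒_)
open import Relation.Binary.Definitions using (Reflexive; Transitive)
open import Relation.Binary.PropositionalEquality using (_≡_; refl; sym; trans; subst; cong)
open import Relation.Binary.Construct.Closure.ReflexiveTransitive using (Star; ε; _◅_; _◅◅_)
import Relation.Binary.Construct.Closure.ReflexiveTransitive as Star
open import Relation.Binary.Construct.Closure.Symmetric using (SymClosure; fwd; bwd)
import Relation.Binary.Construct.Closure.Symmetric as SymClosure
open import Relation.Binary.Construct.Closure.Equivalence using (symmetric)
import Relation.Binary.Construct.Closure.Equivalence as EqClosure
open import Induction.WellFounded using (Acc; acc)

module Theory (P : Presentation) where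
  open Presentation P
  open Over P

  private
    variable
      Q R : M → M → Set
      Γ Δ : List M
      a b c A B K T W : M

  ctx-at : ∀ {n} (f : Sym n) (xs : Vec M n) (i : Fin n) →
           Ctx Q a b → Ctx Q (fun f (xs [ i ]≔ a)) (fun f (xs [ i ]≔ b))
  ctx-at {Q} {a} {b} f xs i s =
    subst (λ ys → Ctx Q (fun f (xs [ i ]≔ a)) (fun f ys)) ([]≔-idempotent xs i)
      (funC f (xs [ i ]≔ a) i (subst (λ t → Ctx Q t b) (sym (lookup∘update i xs a)) s))

  ctx-flip : Ctx Q a b → Ctx (flip Q) b a
  ctx-flip (root s)   = root s
  ctx-flip (pubC s)   = pubC (ctx-flip s)
  ctx-flip (signˡ s)  = signˡ (ctx-flip s)
  ctx-flip (signʳ s)  = signʳ (ctx-flip s)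
  ctx-flip (blindˡ s) = blindˡ (ctx-flip s)
  ctx-flip (blindʳ s) = blindʳ (ctx-flip s)
  ctx-flip (pairˡ s)  = pairˡ (ctx-flip s)
  ctx-flip (pairʳ s)  = pairʳ (ctx-flip s)
  ctx-flip (encˡ s)   = encˡ (ctx-flip s)
  ctx-flip (encʳ s)   = encʳ (ctx-flip s)
  ctx-flip {Q} (funC f xs i {B} s) =
    subst (λ ys → Ctx (flip Q) (fun f (xs [ i ]≔ B)) (fun f ys)) ([]≔-lookup xs i)
      (ctx-at f xs i (ctx-flip s))

  ≈E-cong : (g : M → M) → (∀ {Q a b} → Ctx Q a b → Ctx Q (g a) (g b)) →
            a ≈E b → g a ≈E g b
  ≈E-cong g h = EqClosure.gmap g (Sum.map h h)

  vec-cong : ∀ {n} (g : Vec M n → M) →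
             (∀ xs i {a b} → a ≈E b → g (xs [ i ]≔ a) ≈E g (xs [ i ]≔ b)) →
             ∀ xs ys → (∀ i → lookup xs i ≈E lookup ys i) → g xs ≈E g ys
  vec-cong g g-at []       []       _  = ε
  vec-cong g g-at (x ∷ xs) (y ∷ ys) pw =
    g-at (x ∷ xs) zero (pw zero) ◅◅
    vec-cong (λ v → g (y ∷ v)) (λ v i → g-at (y ∷ v) (suc i)) xs ys (pw ∘ suc)

  fun-cong : ∀ {n} (f : Sym n) xs ys → (∀ i → lookup xs i ≈E lookup ys i) →
             fun f xs ≈E fun f ys
  fun-cong f = vec-cong (fun f) (λ xs i → ≈E-cong (λ t → fun f (xs [ i ]≔ t)) (ctx-at f xs i))

  lookup-instVec : ∀ {X n} (ts : Vec (ETerm Sym X) n) (σ : X → M) (i : Fin n) →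
                   lookup (instVec ts σ) i ≡ inst (lookup ts i) σ
  lookup-instVec (t ∷ ts) σ zero    = refl
  lookup-instVec (t ∷ ts) σ (suc i) = lookup-instVec ts σ i

  _⇝_ : M → M → Set
  a ⇝ b = SymClosure (Ctx ACAxiom) a b ⊎ a ⟶ b

  Red : M → M → Set
  Red = Star _⇝_

  ac⇒red : a ≡AC b → Red a b
  ac⇒red = Star.map inj₁

  ⟶ₐ*⇒red : a ⟶ₐ* b → Red a b
  ⟶ₐ*⇒red ε = ε
  ⟶ₐ*⇒red ((_ , _ , p , s , q) ◅ r) = ac⇒red p ◅◅ inj₂ s ◅ ac⇒red q ◅◅ ⟶ₐ*⇒red r

  red⇒≈E : Red a b → a ≈E b
  red⇒≈E = Star.map λ { (inj₁ s) → SymClosure.map inj₂ s ; (inj₂ s) → fwd (inj₁ s) }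

  normal-red : Normal a → a ≡AC b → Red b c → a ≡AC c
  normal-red n p ε            = p
  normal-red n p (inj₁ s ◅ r) = normal-red n (p ◅◅ s ◅ ε) r
  normal-red n p (inj₂ s ◅ r) = ⊥-elim (n _ (_ , _ , p , s , ε))

  normal-under : (g : M → M) → (∀ {Q a b} → Ctx Q a b → Ctx Q (g a) (g b)) →
                 Normal (g a) → Normal a
  normal-under g h n b (a' , b' , p , s , q) =
    n (g b) (g a' , g b' , EqClosure.gmap g h p , h s , EqClosure.gmap g h q)

  data Shape (R : M → M → Set) : M → M → Set where
    sFun   : ∀ {n} {f : Sym n} {xs b} → Shape R (fun f xs) b
    sName  : ∀ {k} → Shape R (name k) (name k)
    sPub   : ∀ {a a'} → R a a' → Shape R (pub a) (pub a')
    sSign  : ∀ {a b a' b'} → R a a' → R b b' → Shape R (sign a b) (sign a' b')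
    sBlind : ∀ {a b a' b'} → R a a' → R b b' → Shape R (blind a b) (blind a' b')
    sPair  : ∀ {a b a' b'} → R a a' → R b b' → Shape R ⟨ a , b ⟩ ⟨ a' , b' ⟩
    sEnc   : ∀ {a b a' b'} → R a a' → R b b' → Shape R (enc a b) (enc a' b')

  shape-refl : Reflexive R → Reflexive (Shape R)
  shape-refl r {name _}    = sName
  shape-refl r {pub _}     = sPub r
  shape-refl r {sign _ _}  = sSign r r
  shape-refl r {blind _ _} = sBlind r r
  shape-refl r {⟨ _ , _ ⟩} = sPair r r
  shape-refl r {enc _ _}   = sEnc r r
  shape-refl r {fun _ _}   = sFun

  shape-trans : Transitive R → Transitive (Shape R)
  shape-trans t sFun         _              = sFun
  shape-trans t sName        sName          = sName
  shape-trans t (sPub p)     (sPub p')      = sPub (t p p')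
  shape-trans t (sSign p q)  (sSign p' q')  = sSign (t p p') (t q q')
  shape-trans t (sBlind p q) (sBlind p' q') = sBlind (t p p') (t q q')
  shape-trans t (sPair p q)  (sPair p' q')  = sPair (t p p') (t q q')
  shape-trans t (sEnc p q)   (sEnc p' q')   = sEnc (t p p') (t q q')

  non-alien-shape : ¬ Alien a → Shape R a b
  non-alien-shape {fun _ _}   _ = sFun
  non-alien-shape {name _}    h = ⊥-elim (h tt)
  non-alien-shape {pub _}     h = ⊥-elim (h tt)
  non-alien-shape {sign _ _}  h = ⊥-elim (h tt)
  non-alien-shape {blind _ _} h = ⊥-elim (h tt)
  non-alien-shape {⟨ _ , _ ⟩} h = ⊥-elim (h tt)
  non-alien-shape {enc _ _}   h = ⊥-elim (h tt)

  ctx-shape : Reflexive R → (∀ {a b} → Q a b → ¬ Alien a) → Ctx Q ⇒ R → Ctx Q ⇒ Shape R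
  ctx-shape r lhs inner (root s)        = non-alien-shape (lhs s)
  ctx-shape r lhs inner (pubC s)        = sPub (inner s)
  ctx-shape r lhs inner (signˡ s)       = sSign (inner s) r
  ctx-shape r lhs inner (signʳ s)       = sSign r (inner s)
  ctx-shape r lhs inner (blindˡ s)      = sBlind (inner s) r
  ctx-shape r lhs inner (blindʳ s)      = sBlind r (inner s)
  ctx-shape r lhs inner (pairˡ s)       = sPair (inner s) r
  ctx-shape r lhs inner (pairʳ s)       = sPair r (inner s)
  ctx-shape r lhs inner (encˡ s)        = sEnc (inner s) r
  ctx-shape r lhs inner (encʳ s)        = sEnc r (inner s)
  ctx-shape r lhs inner (funC _ _ _ _)  = sFun

  ac-lhs : ACAxiom a b → ¬ Alien a
  ac-lhs (comm _ _ _)    ()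
  ac-lhs (assoc _ _ _ _) ()

  ac-rhs : ACAxiom a b → ¬ Alien b
  ac-rhs (comm _ _ _)    ()
  ac-rhs (assoc _ _ _ _) ()

  -- No rule x → r has a variable left-hand side: it would rewrite every term a
  -- to r[a/x], giving an infinite reduction from any term.
  lhs-not-var : Terminating → ∀ {x r} → (var x , r) ∈ rules → ⊥
  lhs-not-var term {x} {r} mem = diverge (term (name 0))
    where
    diverge : Acc (flip _⟶ₐ_) a → ⊥
    diverge {a} (acc rs) = diverge (rs (a , _ , ε , root (rule mem (λ _ → a)) , ε))

  root-lhs : Terminating → RootStep a b → ¬ Alien a
  root-lhs term (rule {var _}   mem _) = ⊥-elim (lhs-not-var term mem)
  root-lhs term (rule {app _ _} _   _) ()

  _⊢N*_ : List M → List M → Set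
  Δ ⊢N* Γ = ∀ {B} → B ∈ Γ → Δ ⊢N B

  _∷N_ : Δ ⊢N A → Δ ⊢N* Γ → Δ ⊢N* (A ∷ Γ)
  (d ∷N σ) (here refl) = d
  (d ∷N σ) (there p)   = σ p

  infixr 5 _∷N_

  substN : Γ ⊢N A → Δ ⊢N* Γ → Δ ⊢N A
  substN (idN x)       σ = σ x
  substN (eE d k)      σ = eE (substN d σ) (substN k σ)
  substN (eI d k)      σ = eI (substN d σ) (substN k σ)
  substN (pE₁ d)       σ = pE₁ (substN d σ)
  substN (pE₂ d)       σ = pE₂ (substN d σ)
  substN (pI d k)      σ = pI (substN d σ) (substN k σ)
  substN (signE d k)   σ = signE (substN d σ) (substN k σ)
  substN (signI d k)   σ = signI (substN d σ) (substN k σ)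
  substN (blindE₁ d k) σ = blindE₁ (substN d σ) (substN k σ)
  substN (blindI d k)  σ = blindI (substN d σ) (substN k σ)
  substN (blindE₂ d k) σ = blindE₂ (substN d σ) (substN k σ)
  substN (fI f xs ds)  σ = fI f xs (λ i → substN (ds i) σ)
  substN (eqE d e)     σ = eqE (substN d σ) e

  instN    : ∀ {X} (C : ETerm Sym X) {ms : X → M} → (∀ x → Γ ⊢N ms x) → Γ ⊢N inst C ms
  instVecN : ∀ {X n} (ts : Vec (ETerm Sym X) n) {ms : X → M} → (∀ x → Γ ⊢N ms x) →
             ∀ i → Γ ⊢N lookup (instVec ts ms) i
  instN (var x)    ds = ds x
  instN (app f ts) ds = fI f _ (instVecN ts ds)
  instVecN (t ∷ ts) ds zero    = instN t ds
  instVecN (t ∷ ts) ds (suc i) = instVecN ts ds i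

  sound : Γ ⊢S T → Γ ⊢N T
  sound (idS k C ms mem e) = eqE (instN C (λ i → idN (mem i))) e
  sound (cut _ d e)        = substN (sound e) (sound d ∷N idN)
  sound (acut _ d e)       = substN (sound e) (sound d ∷N idN)
  sound (pL m d)           = substN (sound d) (pE₁ (idN m) ∷N pE₂ (idN m) ∷N idN)
  sound (pR a b)           = pI (sound a) (sound b)
  sound (eL m k d)         = substN (sound d) (eE (idN m) (sound k) ∷N sound k ∷N idN)
  sound (eR a b)           = eI (sound a) (sound b)
  sound (signL m₁ m₂ e d)  =
    substN (sound d) (signE (idN m₁) (eqE (idN m₂) (≈E-cong pub pubC (red⇒≈E (ac⇒red e)))) ∷N idN)
  sound (signR a b)        = signI (sound a) (sound b)
  sound (blindL₁ m k d)    = substN (sound d) (blindE₁ (idN m) (sound k) ∷N sound k ∷N idN)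
  sound (blindR a b)       = blindI (sound a) (sound b)
  sound (blindL₂ m k d)    = substN (sound d) (blindE₂ (idN m) (sound k) ∷N sound k ∷N idN)

  weaken : Γ ⊆ Δ → Γ ⊢S T → Δ ⊢S T
  weaken s (idS k C ms mem e)       = idS k C ms (s ∘ mem) e
  weaken s (cut n d e)              = cut n (weaken s d) (weaken (∷⁺ʳ _ s) e)
  weaken s (pL m d)                 = pL (s m) (weaken (∷⁺ʳ _ (∷⁺ʳ _ s)) d)
  weaken s (pR a b)                 = pR (weaken s a) (weaken s b)
  weaken s (eL m k d)               = eL (s m) (weaken s k) (weaken (∷⁺ʳ _ (∷⁺ʳ _ s)) d)
  weaken s (eR a b)                 = eR (weaken s a) (weaken s b)
  weaken s (signL m₁ m₂ e d)        = signL (s m₁) (s m₂) e (weaken (∷⁺ʳ _ s) d)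
  weaken s (signR a b)              = signR (weaken s a) (weaken s b)
  weaken s (blindL₁ m k d)          = blindL₁ (s m) (weaken s k) (weaken (∷⁺ʳ _ (∷⁺ʳ _ s)) d)
  weaken s (blindR a b)             = blindR (weaken s a) (weaken s b)
  weaken s (blindL₂ m k d)          = blindL₂ (s m) (weaken s k) (weaken (∷⁺ʳ _ (∷⁺ʳ _ s)) d)
  weaken s (acut (N , m , f) d e)   = acut (N , ∷⁺ʳ _ s m , f) (weaken s d) (weaken (∷⁺ʳ _ s) e)

  weaken¹ : Γ ⊢S T → A ∷ Γ ⊢S T
  weaken¹ = weaken (xs⊆x∷xs _ _)

  hyp : A ∈ Γ → B ≈E A → Γ ⊢S B
  hyp {A} m e = idS 1 (var zero) (λ _ → A) (λ _ → m) e

  cut-all : ∀ {n} (N : Fin n → M) → (∀ i → Normal (N i)) → (∀ i → Γ ⊢S N i) →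
            (∀ {Θ} → Γ ⊆ Θ → (∀ i → N i ∈ Θ) → Θ ⊢S T) → Γ ⊢S T
  cut-all {n = zero}  N normal ds k = k (λ p → p) (λ ())
  cut-all {n = suc n} N normal ds k =
    cut (normal zero) (ds zero)
      (cut-all (N ∘ suc) (normal ∘ suc) (weaken¹ ∘ ds ∘ suc)
        (λ s mem → k (s ∘ there) λ { zero → s (here refl) ; (suc i) → mem i }))

  module Completeness (term : Terminating) (nf : M → M)
                      (nf-spec : ∀ A → NormalFormOf (nf A) A) where

    step-shape : a ⇝ b → Shape Red a b
    step-shape (inj₁ (fwd s)) = ctx-shape ε ac-lhs (λ t → inj₁ (fwd t) ◅ ε) s
    step-shape (inj₁ (bwd s)) = ctx-shape ε ac-rhs (λ t → inj₁ (bwd (ctx-flip t)) ◅ ε) (ctx-flip s)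
    step-shape (inj₂ s)       = ctx-shape ε (root-lhs term) (λ t → inj₂ t ◅ ε) s

    red-shape : Red a b → Shape Red a b
    red-shape ε       = shape-refl ε
    red-shape (s ◅ r) = shape-trans _◅◅_ (step-shape s) (red-shape r)

    Decomposes : (M → M → M) → M → M → M → Set
    Decomposes c a b W = ∃₂ λ X Y → W ≡ c X Y × Red a X × Red b Y

    red-pub : Red (pub a) W → ∃ λ X → W ≡ pub X × Red a X
    red-pub r with red-shape r
    ... | sPub p = _ , refl , p

    red-sign : Red (sign a b) W → Decomposes sign a b W
    red-sign r with red-shape r
    ... | sSign p q = _ , _ , refl , p , q

    red-blind : Red (blind a b) W → Decomposes blind a b W
    red-blind r with red-shape r
    ... | sBlind p q = _ , _ , refl , p , q

    red-pair : Red ⟨ a , b ⟩ W → Decomposes ⟨_,_⟩ a b W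
    red-pair r with red-shape r
    ... | sPair p q = _ , _ , refl , p , q

    red-enc : Red (enc a b) W → Decomposes enc a b W
    red-enc r with red-shape r
    ... | sEnc p q = _ , _ , refl , p , q

    nf-red : ∀ A → Red A (nf A)
    nf-red A with nf-spec A
    ... | (_ , r , p) , _ = ⟶ₐ*⇒red r ◅◅ ac⇒red p

    nf-normal : ∀ A → Normal (nf A)
    nf-normal A = proj₂ (nf-spec A)

    nf≈ : ∀ A → nf A ≈E A
    nf≈ A = symmetric _ (red⇒≈E (nf-red A))

    nf≈red : Red A W → nf A ≈E W
    nf≈red {A} r = nf≈ A ◅◅ red⇒≈E r

    red⁻ : Red a b → b ≈E a
    red⁻ r = symmetric _ (red⇒≈E r)

    conv : Γ ⊢S nf A → B ≈E A → Γ ⊢S B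
    conv {A = A} d e = cut (nf-normal A) d (hyp (here refl) (e ◅◅ symmetric _ (nf≈ A)))

    cut-nf : Γ ⊢S nf A → nf A ≡ W → W ∷ Γ ⊢S T → Γ ⊢S T
    cut-nf {A = A} d refl e = cut (nf-normal A) d e

    by-right : (c : M → M → M) → (∀ {a b W} → Red (c a b) W → Decomposes c a b W) →
               (∀ {Δ X Y} → Δ ⊢S X → Δ ⊢S Y → Δ ⊢S c X Y) →
               Γ ⊢S nf A → Γ ⊢S nf K → Γ ⊢S nf (c A K)
    by-right {Γ} {A} {K} c decompose right dA dK with decompose (nf-red (c A K))
    ... | X , Y , eq , rX , rY =
      subst (Γ ⊢S_) (sym eq) (right (conv dA (red⁻ rX)) (conv dK (red⁻ rY)))

    by-left : (c : M → M → M) → (∀ {a b W} → Red (c a b) W → Decomposes c a b W) →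
              (∀ {Δ X Y T} → c X Y ∈ Δ → Δ ⊢S Y → X ∷ Y ∷ Δ ⊢S T → Δ ⊢S T) →
              Γ ⊢S nf (c A K) → Γ ⊢S nf K → Γ ⊢S nf A
    by-left {A = A} {K} c decompose left d dK with decompose (nf-red (c A K))
    ... | X , Y , eq , rX , rY =
      cut-nf d eq (left (here refl) (conv (weaken¹ dK) (red⁻ rY)) (hyp (here refl) (nf≈red rX)))

    fun-nf≈ : ∀ {n} (f : Sym n) (xs : Vec M n) →
              nf (fun f xs) ≈E inst (app f (tabulate var)) (λ i → nf (lookup xs i))
    fun-nf≈ f xs = nf≈ (fun f xs) ◅◅ fun-cong f xs _ argument
      where
      ms : Fin _ → M
      ms i = nf (lookup xs i)

      hole : ∀ i → lookup (instVec (tabulate var) ms) i ≡ ms i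
      hole i = trans (lookup-instVec (tabulate var) ms i) (cong (λ t → inst t ms) (lookup∘tabulate var i))

      argument : ∀ i → lookup xs i ≈E lookup (instVec (tabulate var) ms) i
      argument i = subst (lookup xs i ≈E_) (sym (hole i)) (symmetric _ (nf≈ (lookup xs i)))

    complete : Γ ⊢N A → map nf Γ ⊢S nf A
    complete (idN m)       = hyp (∈-map⁺ nf m) ε
    complete (eqE {A} d e) = conv (complete d) (nf≈ A ◅◅ e)
    complete (eI a k)      = by-right enc red-enc eR (complete a) (complete k)
    complete (pI a b)      = by-right ⟨_,_⟩ red-pair pR (complete a) (complete b)
    complete (signI a k)   = by-right sign red-sign signR (complete a) (complete k)
    complete (blindI a k)  = by-right blind red-blind blindR (complete a) (complete k)
    complete (eE d k)      = by-left enc red-enc eL (complete d) (complete k)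
    complete (blindE₁ d k) = by-left blind red-blind blindL₁ (complete d) (complete k)
    complete (pE₁ {A} {B} d) with red-pair (nf-red ⟨ A , B ⟩)
    ... | _ , _ , eq , rA , _ = cut-nf (complete d) eq (pL (here refl) (hyp (here refl) (nf≈red rA)))
    complete (pE₂ {A} {B} d) with red-pair (nf-red ⟨ A , B ⟩)
    ... | _ , _ , eq , _ , rB = cut-nf (complete d) eq (pL (here refl) (hyp (there (here refl)) (nf≈red rB)))
    complete (signE {A} {K} d k) with red-sign (nf-red (sign A K))
    ... | X , Y , eq , rX , rY with red-pub (nf-red (pub Y))
    ... | Z , eqZ , rZ =
      cut-nf (complete d) eq
        (cut-nf (weaken¹ (conv (complete k) (nf≈ (pub Y) ◅◅ ≈E-cong pub pubC (red⁻ rY)))) eqZ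
          (signL (there (here refl)) (here refl) Y≡Z (hyp (here refl) (nf≈red rX))))
      where
      -- Y is normal as an argument of the normal form sign(X,Y), so its reduct Z is AC-equal to it.
      Y≡Z : Y ≡AC Z
      Y≡Z = normal-red (normal-under (sign X) signʳ (subst Normal eq (nf-normal _))) ε rZ
    complete (blindE₂ {A} {R} {K} d r) with red-sign (nf-red (sign (blind A R) K))
    ... | _ , Y , eq , rBlind , rY with red-blind rBlind
    ... | X , _ , refl , rX , rR =
      cut-nf (complete d) eq
        (blindL₂ (here refl) (conv (weaken¹ (complete r)) (red⁻ rR))
          (hyp (here refl)
            (nf≈ (sign A K) ◅◅ ≈E-cong (λ t → sign t K) signˡ (red⇒≈E rX) ◅◅ ≈E-cong (sign X) signʳ (red⇒≈E rY))))
    complete (fI f xs ds)  =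
      cut-all (λ i → nf (lookup xs i)) (λ i → nf-normal _) (λ i → complete (ds i))
        (λ _ mem → idS _ (app f (tabulate var)) _ mem (fun-nf≈ f xs))

    -- Each hypothesis ↓B is derivable from Γ, so soundness of 𝒮 transfers back.
    soundness : map nf Γ ⊢S nf A → Γ ⊢N A
    soundness {Γ} {A} d = eqE (substN (sound d) from-nf) (symmetric _ (nf≈ A))
      where
      from-nf : Γ ⊢N* map nf Γ
      from-nf p with ∈-map⁻ nf p
      ... | B , m , refl = eqE (idN m) (nf≈ B)

proposition2p7 : (P : Presentation) → let open Over P in
    Terminating → ConfluentModAC →
    (nf : M → M) → (∀ A → NormalFormOf (nf A) A) →
    (Γ : List M) (A : M) → (Γ ⊢N A) ⇔ (map nf Γ ⊢S nf A)
proposition2p7 P term _ nf nf-spec Γ A = mk⇔ complete soundness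
  where open Theory.Completeness P term nf nf-spec
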